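{- Let $A_1,\dots,A_n$ ($n\ge1$) be residuated lattices, $A=\prod_{i=1}^n A_i$ their direct product, and for each $i$ let $(L_i,\lambda_i)$ be a reticulation of $A_i$. Define $\lambda:A\to\prod_{i=1}^n L_i$ by $\lambda(a_1,\dots,a_n)=(\lambda_1(a_1),\dots,\lambda_n(a_n))$. Then $(\prod_{i=1}^n L_i,\lambda)$ is a reticulation of $A$. In particular, the reticulation of a finite direct product of residuated lattices is isomorphic to the direct product of their reticulations.
   Context: A residuated lattice is an algebra $(A,\vee,\wedge,\odot,\rightarrow,0,1)$ such that $(A,\vee,\wedge,0,1)$ is a bounded lattice, $(A,\odot,1)$ is a commutative monoid, and for all $a,b,c\in A$: $a\le b\rightarrow c$ iff $a\odot b\le c$. Write $a^n=a\odot\cdots\odot a$. A reticulation of a residuated lattice $A$ is a pair $(L,\lambda)$ with $L$ a bounded distributive lattice and $\lambda:A\to L$ a function such that for all $a,b\in A$: (1) $\lambda(a\odot b)=\lambda(a)\wedge\lambda(b)$; (2) $\lambda(a\vee b)=\lambda(a)\vee\lambda(b)$; (3) $\lambda(0)=0$, $\lambda(1)=1$; (4) $\lambda$ is surjective; (5) $\lambda(a)\le\lambda(b)$ iff there is $n\ge 1$ with $a^n\le b$. Every residuated lattice has a reticulation, unique up to a lattice isomorphism commuting with the maps $\lambda$. -}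

module Defs where

open import Level using (Level; _⊔_) renaming (suc to lsuc)
open import Data.Nat using (ℕ; zero; suc; _≤_)
open import Data.Fin using (Fin)
open import Data.Product using (Σ; _×_; _,_; proj₁; proj₂)
open import Function.Bundles using (_⇔_; mk⇔)
open import Relation.Binary.Core using (Rel)
open import Relation.Binary.Structures using (IsEquivalence)
open import Algebra.Core using (Op₂)
open import Algebra.Structures using (IsCommutativeMonoid; IsMonoid; IsSemigroup; IsMagma)
open import Algebra.Lattice.Structures using (IsLattice; IsDistributiveLattice)

record ResiduatedLattice (c ℓ : Level) : Set (lsuc (c ⊔ ℓ)) where
  infix  4 _≈_ _≤ᴿ_
  infixr 5 _⇒_
  infixl 6 _⊙_
  infixr 7 _∨_ _∧_
  field
    Carrier   : Set c
    _≈_       : Rel Carrier ℓ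
    _∨_       : Op₂ Carrier
    _∧_       : Op₂ Carrier
    _⊙_       : Op₂ Carrier
    _⇒_       : Op₂ Carrier
    𝟘         : Carrier
    𝟙         : Carrier
    isLattice : IsLattice _≈_ _∨_ _∧_
    ⊙-isCommutativeMonoid : IsCommutativeMonoid _≈_ _⊙_ 𝟙
    ⇒-cong    : ∀ {x x′ y y′} → x ≈ x′ → y ≈ y′ → (x ⇒ y) ≈ (x′ ⇒ y′)

  _≤ᴿ_ : Rel Carrier ℓ
  x ≤ᴿ y = (x ∧ y) ≈ x

  field
    𝟘-least    : ∀ x → 𝟘 ≤ᴿ x
    𝟙-greatest : ∀ x → x ≤ᴿ 𝟙
    residuation : ∀ a b c → (a ≤ᴿ (b ⇒ c)) ⇔ ((a ⊙ b) ≤ᴿ c)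

  _^_ : Carrier → ℕ → Carrier
  a ^ zero  = 𝟙
  a ^ suc n = a ⊙ (a ^ n)

record BoundedDistributiveLattice (c ℓ : Level) : Set (lsuc (c ⊔ ℓ)) where
  infix  4 _≈_ _≤ᴸ_
  infixr 7 _∨_ _∧_
  field
    Carrier   : Set c
    _≈_       : Rel Carrier ℓ
    _∨_       : Op₂ Carrier
    _∧_       : Op₂ Carrier
    ⊥         : Carrier
    ⊤         : Carrier
    isDistributiveLattice : IsDistributiveLattice _≈_ _∨_ _∧_

  _≤ᴸ_ : Rel Carrier ℓ
  x ≤ᴸ y = (x ∧ y) ≈ x

  field
    ⊥-least    : ∀ x → ⊥ ≤ᴸ x
    ⊤-greatest : ∀ x → x ≤ᴸ ⊤

record IsReticulation {c ℓ c′ ℓ′ : Level}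
    (A : ResiduatedLattice c ℓ) (L : BoundedDistributiveLattice c′ ℓ′)
    (λ′ : ResiduatedLattice.Carrier A → BoundedDistributiveLattice.Carrier L)
    : Set (c ⊔ ℓ ⊔ c′ ⊔ ℓ′) where
  module A = ResiduatedLattice A
  module L = BoundedDistributiveLattice L
  field
    cong        : ∀ {a b} → a A.≈ b → λ′ a L.≈ λ′ b
    pres-⊙      : ∀ a b → λ′ (a A.⊙ b) L.≈ (λ′ a L.∧ λ′ b)
    pres-∨      : ∀ a b → λ′ (a A.∨ b) L.≈ (λ′ a L.∨ λ′ b)
    pres-𝟘      : λ′ A.𝟘 L.≈ L.⊥
    pres-𝟙      : λ′ A.𝟙 L.≈ L.⊤
    surjective  : ∀ y → Σ A.Carrier (λ a → λ′ a L.≈ y)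
    order       : ∀ a b → (λ′ a L.≤ᴸ λ′ b) ⇔ Σ ℕ (λ n → (1 ≤ n) × (a A.^ n) A.≤ᴿ b)

module _ {n : ℕ} {c ℓ : Level} {C : Fin n → Set c} (R : ∀ i → Rel (C i) ℓ) where

  Πrel : Rel ((i : Fin n) → C i) ℓ
  Πrel x y = ∀ i → R i (x i) (y i)

  Πequiv : (∀ i → IsEquivalence (R i)) → IsEquivalence Πrel
  Πequiv e = record
    { refl  = λ i → IsEquivalence.refl (e i)
    ; sym   = λ p i → IsEquivalence.sym (e i) (p i)
    ; trans = λ p q i → IsEquivalence.trans (e i) (p i) (q i) }

  Πop : (∀ i → Op₂ (C i)) → Op₂ ((i : Fin n) → C i)
  Πop f x y i = f i (x i) (y i)

  ΠisLattice : ∀ {∨ ∧ : ∀ i → Op₂ (C i)} → (∀ i → IsLattice (R i) (∨ i) (∧ i))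
             → IsLattice Πrel (Πop ∨) (Πop ∧)
  ΠisLattice L = record
    { isEquivalence = Πequiv (λ i → IsLattice.isEquivalence (L i))
    ; ∨-comm  = λ x y i → IsLattice.∨-comm (L i) (x i) (y i)
    ; ∨-assoc = λ x y z i → IsLattice.∨-assoc (L i) (x i) (y i) (z i)
    ; ∨-cong  = λ p q i → IsLattice.∨-cong (L i) (p i) (q i)
    ; ∧-comm  = λ x y i → IsLattice.∧-comm (L i) (x i) (y i)
    ; ∧-assoc = λ x y z i → IsLattice.∧-assoc (L i) (x i) (y i) (z i)
    ; ∧-cong  = λ p q i → IsLattice.∧-cong (L i) (p i) (q i)
    ; absorptive = (λ x y i → proj₁ (IsLattice.absorptive (L i)) (x i) (y i))
                 , (λ x y i → proj₂ (IsLattice.absorptive (L i)) (x i) (y i)) }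

  ΠisDistributiveLattice : ∀ {∨ ∧ : ∀ i → Op₂ (C i)}
    → (∀ i → IsDistributiveLattice (R i) (∨ i) (∧ i))
    → IsDistributiveLattice Πrel (Πop ∨) (Πop ∧)
  ΠisDistributiveLattice D = record
    { isLattice = ΠisLattice (λ i → IsDistributiveLattice.isLattice (D i))
    ; ∨-distrib-∧ = (λ x y z i → proj₁ (IsDistributiveLattice.∨-distrib-∧ (D i)) (x i) (y i) (z i))
                  , (λ x y z i → proj₂ (IsDistributiveLattice.∨-distrib-∧ (D i)) (x i) (y i) (z i))
    ; ∧-distrib-∨ = (λ x y z i → proj₁ (IsDistributiveLattice.∧-distrib-∨ (D i)) (x i) (y i) (z i))
                  , (λ x y z i → proj₂ (IsDistributiveLattice.∧-distrib-∨ (D i)) (x i) (y i) (z i)) }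

  ΠisCommutativeMonoid : ∀ {∙ : ∀ i → Op₂ (C i)} {e : ∀ i → C i}
    → (∀ i → IsCommutativeMonoid (R i) (∙ i) (e i))
    → IsCommutativeMonoid Πrel (Πop ∙) e
  ΠisCommutativeMonoid M = record
    { isMonoid = record
      { isSemigroup = record
        { isMagma = record
          { isEquivalence = Πequiv (λ i → IsCommutativeMonoid.isEquivalence (M i))
          ; ∙-cong = λ p q i → IsCommutativeMonoid.∙-cong (M i) (p i) (q i) }
        ; assoc = λ x y z i → IsCommutativeMonoid.assoc (M i) (x i) (y i) (z i) }
      ; identity = (λ x i → proj₁ (IsCommutativeMonoid.identity (M i)) (x i))
                 , (λ x i → proj₂ (IsCommutativeMonoid.identity (M i)) (x i)) }
    ; comm = λ x y i → IsCommutativeMonoid.comm (M i) (x i) (y i) }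

ΠRL : ∀ {c ℓ} (n : ℕ) → (Fin n → ResiduatedLattice c ℓ) → ResiduatedLattice c ℓ
ΠRL n A = record
  { Carrier = (i : Fin n) → Carrier (A i)
  ; _≈_ = Πrel (λ i → _≈_ (A i))
  ; _∨_ = Πop (λ i → _≈_ (A i)) (λ i → _∨_ (A i))
  ; _∧_ = Πop (λ i → _≈_ (A i)) (λ i → _∧_ (A i))
  ; _⊙_ = Πop (λ i → _≈_ (A i)) (λ i → _⊙_ (A i))
  ; _⇒_ = Πop (λ i → _≈_ (A i)) (λ i → _⇒_ (A i))
  ; 𝟘 = λ i → 𝟘 (A i)
  ; 𝟙 = λ i → 𝟙 (A i)
  ; isLattice = ΠisLattice _ (λ i → isLattice (A i))
  ; ⊙-isCommutativeMonoid = ΠisCommutativeMonoid _ (λ i → ⊙-isCommutativeMonoid (A i))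
  ; ⇒-cong = λ p q i → ⇒-cong (A i) (p i) (q i)
  ; 𝟘-least = λ x i → 𝟘-least (A i) (x i)
  ; 𝟙-greatest = λ x i → 𝟙-greatest (A i) (x i)
  ; residuation = λ a b c → mk⇔
      (λ p i → Function.Bundles.Equivalence.to (residuation (A i) (a i) (b i) (c i)) (p i))
      (λ p i → Function.Bundles.Equivalence.from (residuation (A i) (a i) (b i) (c i)) (p i))
  }
  where open ResiduatedLattice

ΠBDL : ∀ {c ℓ} (n : ℕ) → (Fin n → BoundedDistributiveLattice c ℓ) → BoundedDistributiveLattice c ℓ
ΠBDL n L = record
  { Carrier = (i : Fin n) → Carrier (L i)
  ; _≈_ = Πrel (λ i → _≈_ (L i))
  ; _∨_ = Πop (λ i → _≈_ (L i)) (λ i → _∨_ (L i))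
  ; _∧_ = Πop (λ i → _≈_ (L i)) (λ i → _∧_ (L i))
  ; ⊥ = λ i → ⊥ (L i)
  ; ⊤ = λ i → ⊤ (L i)
  ; isDistributiveLattice = ΠisDistributiveLattice _ (λ i → isDistributiveLattice (L i))
  ; ⊥-least = λ x i → ⊥-least (L i) (x i)
  ; ⊤-greatest = λ x i → ⊤-greatest (L i) (x i)
  }
  where open BoundedDistributiveLattice

Πmap : ∀ {c ℓ c′ ℓ′} (n : ℕ) (A : Fin n → ResiduatedLattice c ℓ)
       (L : Fin n → BoundedDistributiveLattice c′ ℓ′)
       (λs : ∀ i → ResiduatedLattice.Carrier (A i) → BoundedDistributiveLattice.Carrier (L i))
     → ResiduatedLattice.Carrier (ΠRL n A) → BoundedDistributiveLattice.Carrier (ΠBDL n L)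
Πmap n A L λs a i = λs i (a i)

-- The map λ acts coordinatewise, and so do all operations of both products, so
-- conditions (1)–(4) of a reticulation hold coordinatewise. For (5), powers in the
-- product are also computed coordinatewise; exponents nᵢ with aᵢ ^ nᵢ ≤ bᵢ can be
-- replaced by their maximum, because a ^ m decreases in m (a ⊙ y ≤ y, as a ≤ 1).
module Submission where

open import Defs
open import Level using (Level)
open import Data.Nat using (ℕ; _≤_; _≤′_; ≤′-refl; ≤′-step; suc; zero; _⊔_; s≤s; z≤n)
open import Data.Nat.Properties using (≤⇒≤′; m≤m⊔n; m≤n⊔m; ≤-trans)
open import Data.Fin using (Fin)
import Data.Fin as Fin
open import Data.Product using (Σ; _×_; _,_; proj₁; proj₂)
open import Function.Bundles using (_⇔_; mk⇔; Equivalence)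
open import Relation.Binary.PropositionalEquality using (_≡_; refl; cong; subst; sym)
open import Algebra.Lattice.Bundles using (Lattice)
import Algebra.Lattice.Properties.Lattice as LatticeProperties
open import Algebra.Structures using (IsCommutativeMonoid)

UpwardClosed : ∀ {ℓ} → (ℕ → Set ℓ) → Set ℓ
UpwardClosed P = ∀ {k m} → k ≤ m → P k → P m

module ResiduatedLatticeProperties {c ℓ : Level} (A : ResiduatedLattice c ℓ) where
  open ResiduatedLattice A

  lattice : Lattice c ℓ
  lattice = record { isLattice = isLattice }

  open Lattice lattice using (∧-assoc; ∧-congˡ; ∧-congʳ; setoid)
  open LatticeProperties lattice using (∧-idem)
  open IsCommutativeMonoid ⊙-isCommutativeMonoid using (identityˡ)
  open import Relation.Binary.Reasoning.Setoid setoid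

  ≤ᴿ-refl : ∀ x → x ≤ᴿ x
  ≤ᴿ-refl = ∧-idem

  ≤ᴿ-trans : ∀ {x y z} → x ≤ᴿ y → y ≤ᴿ z → x ≤ᴿ z
  ≤ᴿ-trans {x} {y} {z} x≤y y≤z = begin
    x ∧ z        ≈⟨ ∧-congʳ x≤y ⟨
    (x ∧ y) ∧ z  ≈⟨ ∧-assoc x y z ⟩
    x ∧ (y ∧ z)  ≈⟨ ∧-congˡ y≤z ⟩
    x ∧ y        ≈⟨ x≤y ⟩
    x            ∎

  ⊙-decreasing : ∀ a y → (a ⊙ y) ≤ᴿ y
  ⊙-decreasing a y = Equivalence.to (residuation a y y)
    (≤ᴿ-trans (𝟙-greatest a) (Equivalence.from (residuation 𝟙 y y) 𝟙⊙y≤y))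
    where
    𝟙⊙y≤y : (𝟙 ⊙ y) ≤ᴿ y
    𝟙⊙y≤y = begin
      (𝟙 ⊙ y) ∧ y  ≈⟨ ∧-congʳ (identityˡ y) ⟩
      y ∧ y        ≈⟨ ∧-idem y ⟩
      y            ≈⟨ identityˡ y ⟨
      𝟙 ⊙ y        ∎

  ^-antitone : ∀ a {k m} → k ≤ m → (a ^ m) ≤ᴿ (a ^ k)
  ^-antitone a k≤m = go (≤⇒≤′ k≤m)
    where
    go : ∀ {k m} → k ≤′ m → (a ^ m) ≤ᴿ (a ^ k)
    go ≤′-refl        = ≤ᴿ-refl _
    go (≤′-step k≤′m) = ≤ᴿ-trans (⊙-decreasing a _) (go k≤′m)

  ^-≤ᴿ-upwardClosed : ∀ a b → UpwardClosed (λ m → (a ^ m) ≤ᴿ b)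
  ^-≤ᴿ-upwardClosed a b k≤m = ≤ᴿ-trans (^-antitone a k≤m)

module ProductProperties {c ℓ : Level} {n : ℕ} (A : Fin n → ResiduatedLattice c ℓ) where
  open ResiduatedLattice

  ^-pointwise : ∀ a m i → _^_ (ΠRL n A) a m i ≡ _^_ (A i) (a i) m
  ^-pointwise a zero    i = refl
  ^-pointwise a (suc m) i = cong (_⊙_ (A i) (a i)) (^-pointwise a m i)

  ^-≤ᴿ-pointwise : ∀ a b m
    → _≤ᴿ_ (ΠRL n A) (_^_ (ΠRL n A) a m) b ⇔ (∀ i → _≤ᴿ_ (A i) (_^_ (A i) (a i) m) (b i))
  ^-≤ᴿ-pointwise a b m = mk⇔
    (λ p i → subst (λ x → _≤ᴿ_ (A i) x (b i)) (^-pointwise a m i) (p i))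
    (λ p i → subst (λ x → _≤ᴿ_ (A i) x (b i)) (sym (^-pointwise a m i)) (p i))

upwardClosed-∀∃⇒∃∀ : ∀ {ℓ} n (P : Fin n → ℕ → Set ℓ) → (∀ i → UpwardClosed (P i))
  → (∀ i → Σ ℕ λ k → 1 ≤ k × P i k) → Σ ℕ λ m → 1 ≤ m × (∀ i → P i m)
upwardClosed-∀∃⇒∃∀ zero    P up h = 1 , s≤s z≤n , λ ()
upwardClosed-∀∃⇒∃∀ (suc n) P up h
  with upwardClosed-∀∃⇒∃∀ n (λ i → P (Fin.suc i)) (λ i → up (Fin.suc i)) (λ i → h (Fin.suc i))
     | h Fin.zero
... | m , 1≤m , Pm | k , _ , Pk = m ⊔ k , ≤-trans 1≤m (m≤m⊔n m k) , P[m⊔k]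
  where
  P[m⊔k] : ∀ i → P i (m ⊔ k)
  P[m⊔k] Fin.zero    = up Fin.zero (m≤n⊔m m k) Pk
  P[m⊔k] (Fin.suc i) = up (Fin.suc i) (m≤m⊔n m k) (Pm i)

module _ {c ℓ c′ ℓ′ : Level} {n : ℕ} (A : Fin n → ResiduatedLattice c ℓ)
         (L : Fin n → BoundedDistributiveLattice c′ ℓ′)
         (λs : ∀ i → ResiduatedLattice.Carrier (A i) → BoundedDistributiveLattice.Carrier (L i))
         (ret : ∀ i → IsReticulation (A i) (L i) (λs i)) where
  open ResiduatedLattice using (_^_; _≤ᴿ_)
  open BoundedDistributiveLattice using (_≤ᴸ_)
  open ProductProperties A using (^-≤ᴿ-pointwise)
  private module Ret i = IsReticulation (ret i)

  Πmap-order : ∀ a b → _≤ᴸ_ (ΠBDL n L) (Πmap n A L λs a) (Πmap n A L λs b)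
             ⇔ Σ ℕ (λ m → (1 ≤ m) × _≤ᴿ_ (ΠRL n A) (_^_ (ΠRL n A) a m) b)
  Πmap-order a b = mk⇔ to from
    where
    ImagesOrdered : Set ℓ′
    ImagesOrdered = _≤ᴸ_ (ΠBDL n L) (Πmap n A L λs a) (Πmap n A L λs b)
    SomePowerBelow : Set ℓ
    SomePowerBelow = Σ ℕ (λ m → (1 ≤ m) × _≤ᴿ_ (ΠRL n A) (_^_ (ΠRL n A) a m) b)

    P : Fin n → ℕ → Set ℓ
    P i m = _≤ᴿ_ (A i) (_^_ (A i) (a i) m) (b i)

    to : ImagesOrdered → SomePowerBelow
    to λa≤λb
      with upwardClosed-∀∃⇒∃∀ n P
             (λ i → ResiduatedLatticeProperties.^-≤ᴿ-upwardClosed (A i) (a i) (b i))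
             (λ i → Equivalence.to (Ret.order i (a i) (b i)) (λa≤λb i))
    ... | m , 1≤m , Pm = m , 1≤m , Equivalence.from (^-≤ᴿ-pointwise a b m) Pm

    from : SomePowerBelow → ImagesOrdered
    from (m , 1≤m , aᵐ≤b) i = Equivalence.from (Ret.order i (a i) (b i))
      (m , 1≤m , Equivalence.to (^-≤ᴿ-pointwise a b m) aᵐ≤b i)

mainTheorem4 : {c ℓ c′ ℓ′ : Level} (n : ℕ) → 1 ≤ n
    → (A : Fin n → ResiduatedLattice c ℓ)
    → (L : Fin n → BoundedDistributiveLattice c′ ℓ′)
    → (λs : ∀ i → ResiduatedLattice.Carrier (A i) → BoundedDistributiveLattice.Carrier (L i))
    → (∀ i → IsReticulation (A i) (L i) (λs i))
    → IsReticulation (ΠRL n A) (ΠBDL n L) (Πmap n A L λs)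
mainTheorem4 n _ A L λs ret = record
  { cong       = λ a≈b i → Ret.cong i (a≈b i)
  ; pres-⊙     = λ a b i → Ret.pres-⊙ i (a i) (b i)
  ; pres-∨     = λ a b i → Ret.pres-∨ i (a i) (b i)
  ; pres-𝟘     = λ i → Ret.pres-𝟘 i
  ; pres-𝟙     = λ i → Ret.pres-𝟙 i
  ; surjective = λ y → (λ i → proj₁ (Ret.surjective i (y i)))
                     , (λ i → proj₂ (Ret.surjective i (y i)))
  ; order      = Πmap-order A L λs ret
  }
  where module Ret i = IsReticulation (ret i)
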